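{- $\tilde r\ge \mathtt h''+1$, where $\mathtt h''$ is the number of indices $i$ with $1\le i<\mathtt h$ and $S_i\ne S_{i+1}$.
   Context: Let $S_1,\dots,S_{\mathtt h}$ be strings (haplotypes), not necessarily distinct, each of length $\mathtt w$ over the ordered alphabet $\{0,\dots,\sigma-1\}$. The prefix array $\mathrm{PA}$ is the $\mathtt h\times\mathtt w$ matrix whose column 1 is $1,\dots,\mathtt h$ and whose column $j>1$ lists the indices $k$ sorted by the co-lexicographic order (comparison from the last symbol backwards) of $S_k[1..j-1]$, ties broken by increasing $k$. The PBWT is the $\mathtt h\times\mathtt w$ matrix with $\mathrm{PBWT}[i][j]=S_{\mathrm{PA}[i][j]}[j]$. A run of column $j$ is a maximal block of consecutive rows with identical symbols in that column of the PBWT; $r_j$ is the number of runs of column $j$ and $\tilde r=\sum_{j=1}^{\mathtt w} r_j$. -}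

module Defs where

open import Data.Bool using (Bool; true; false; if_then_else_; _∧_; _∨_)
open import Data.Nat using (ℕ; zero; suc; _+_; _<ᵇ_; _≡ᵇ_)
open import Data.Fin using (Fin; toℕ)
open import Data.List using (List; []; _∷_; map; take; allFin)
open import Data.Nat.ListAction using (sum)
open import Data.Vec using (Vec; toList; lookup)
open import Relation.Binary.Definitions using (DecidableEquality)
open import Relation.Nullary using (does)
import Data.Vec.Properties
import Data.Fin

-- Haplotypes: h strings of length w over {0,..,σ-1}.  Indices are 0-based:
-- haplotype k : Fin h, column j : Fin w (paper's column j+1).
Haplotypes : ℕ → ℕ → ℕ → Set
Haplotypes h w σ = Fin h → Vec (Fin σ) w

changes : {A : Set} → DecidableEquality A → List A → ℕ
changes _≟_ [] = 0
changes _≟_ (x ∷ []) = 0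
changes _≟_ (x ∷ y ∷ ys) =
  (if does (x ≟ y) then 0 else 1) + changes _≟_ (y ∷ ys)

runs : {A : Set} → DecidableEquality A → List A → ℕ
runs _≟_ [] = 0
runs _≟_ (x ∷ xs) = suc (changes _≟_ (x ∷ xs))

lexLt : List ℕ → List ℕ → Bool
lexLt [] [] = false
lexLt [] (_ ∷ _) = true
lexLt (_ ∷ _) [] = false
lexLt (a ∷ as) (b ∷ bs) = (a <ᵇ b) ∨ ((a ≡ᵇ b) ∧ lexLt as bs)

listEq : List ℕ → List ℕ → Bool
listEq [] [] = true
listEq (a ∷ as) (b ∷ bs) = (a ≡ᵇ b) ∧ listEq as bs
listEq _ _ = false

insertBy : {A : Set} → (A → A → Bool) → A → List A → List A
insertBy lt x [] = x ∷ []
insertBy lt x (y ∷ ys) = if lt x y then x ∷ y ∷ ys else y ∷ insertBy lt x ys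

sortBy : {A : Set} → (A → A → Bool) → List A → List A
sortBy lt [] = []
sortBy lt (x ∷ xs) = insertBy lt x (sortBy lt xs)

reverseL : {A : Set} → List A → List A
reverseL [] = []
reverseL (x ∷ xs) = Data.List._++_ (reverseL xs) (x ∷ [])

module _ {h w σ : ℕ} (S : Haplotypes h w σ) where

  -- the prefix S_k[1..j] (of length j) read backwards, as naturals;
  -- lexicographic order on these = co-lexicographic order on the prefixes
  revPrefix : ℕ → Fin h → List ℕ
  revPrefix j k = reverseL (map toℕ (take j (toList (S k))))

  colexLt : ℕ → Fin h → Fin h → Bool
  colexLt j k k′ =
    lexLt (revPrefix j k) (revPrefix j k′)
    ∨ (listEq (revPrefix j k) (revPrefix j k′) ∧ (toℕ k <ᵇ toℕ k′))

  -- column j (0-based) of the prefix array: indices sorted by S_k[prefix of length j]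
  PAcol : Fin w → List (Fin h)
  PAcol j = sortBy (colexLt (toℕ j)) (allFin h)

  PBWTcol : Fin w → List (Fin σ)
  PBWTcol j = map (λ k → lookup (S k) j) (PAcol j)

  runsCol : Fin w → ℕ
  runsCol j = runs Data.Fin._≟_ (PBWTcol j)

  rTilde : ℕ
  rTilde = sum (map runsCol (allFin w))

  h″ : ℕ
  h″ = changes (Data.Vec.Properties.≡-dec Data.Fin._≟_) (map S (allFin h))

{-# OPTIONS --safe #-}
-- If haplotypes i and i+1 differ, let j be the first position at which they differ. Their
-- prefixes of length j coincide, so in the corresponding column of the prefix array they tie
-- in co-lexicographic order and, ties being broken by index, occupy consecutive rows; as their
-- j-th symbols differ, these rows form a run boundary of that PBWT column. Distinct pairs
-- (i, i+1) give distinct boundaries, so h'' is at most the total number of run boundaries,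
-- which is r̃ - w ≤ r̃ - 1.
module Submission where

open import Defs
open import Data.Bool using (Bool; true; false; T; _∨_; _∧_)
open import Data.Bool.Properties using (T-≡; T-∨; T-∧)
open import Data.Empty using (⊥-elim)
open import Data.Fin using (Fin; zero; suc; toℕ; inject₁; _≟_)
open import Data.Fin.Properties using (toℕ-injective; toℕ-inject₁; suc-injective)
open import Data.List using (List; []; _∷_; _++_; map; length; filter; take; concatMap; tabulate; allFin)
open import Data.List.Properties using (length-++; length-tabulate; map-cong)
open import Data.List.Membership.Propositional using (_∈_; lose)
open import Data.List.Membership.Propositional.Properties
  using (∈-∃++; ∈-allFin; ∈-map⁺; ∈-tabulate⁻; ∈-filter⁺; ∈-filter⁻; ∈-concatMap⁺)
open import Data.List.Relation.Binary.Lex.Strict as Lex using (Lex-<; base; halt; this; next)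
open import Data.List.Relation.Binary.Permutation.Propositional
  using (_↭_; ↭-refl; ↭-sym; ↭-trans; ↭-prep; ↭-swap)
open import Data.List.Relation.Binary.Permutation.Propositional.Properties
  using (∈-resp-↭; All-resp-↭; shift; ↭-length)
open import Data.List.Relation.Binary.Pointwise using (Pointwise; []; _∷_; ≡⇒Pointwise-≡)
open import Data.List.Relation.Binary.Subset.Propositional using (_⊆_)
open import Data.List.Relation.Unary.All as All using (All; []; _∷_)
open import Data.List.Relation.Unary.AllPairs using (AllPairs; []; _∷_)
open import Data.List.Relation.Unary.Any using (here; there)
open import Data.List.Relation.Unary.Unique.Propositional using (Unique)
import Data.List.Relation.Unary.Unique.Propositional.Properties as Unique
open import Data.Nat as ℕ using (ℕ; suc; _+_; _<_; _≤_; _<ᵇ_; _≡ᵇ_; z≤n; s≤s)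
open import Data.Nat.ListAction using (sum)
import Data.Nat.Properties as ℕ
open import Algebra.Properties.CommutativeSemigroup ℕ.+-commutativeSemigroup using (x∙yz≈y∙xz)
open import Data.Product using (_×_; _,_; proj₁; proj₂; ∃-syntax)
import Data.Product as Product
open import Data.Product.Relation.Binary.Lex.Strict using (×-Lex; ×-isStrictTotalOrder)
open import Data.Product.Relation.Binary.Pointwise.NonDependent
  using () renaming (Pointwise to ×-Pointwise)
open import Data.Sum using (_⊎_; inj₁; inj₂)
import Data.Sum as Sum
open import Data.Vec using (Vec; []; _∷_; toList; lookup)
import Data.Vec.Properties as Vec
open import Function using (_∘_; id; Equivalence)
open import Level using (0ℓ)
open import Relation.Binary
  using (Rel; Transitive; Asymmetric; DecidableEquality; IsStrictPartialOrder; IsStrictTotalOrder; tri<; tri≈; tri>)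
open import Relation.Binary.PropositionalEquality
open import Relation.Nullary using (¬_; yes; no; ¬?; contradiction)
open import Relation.Unary using (Decidable)

private
  variable
    A B : Set

adjacentPairs : List A → List (A × A)
adjacentPairs []           = []
adjacentPairs (x ∷ [])     = []
adjacentPairs (x ∷ y ∷ xs) = (x , y) ∷ adjacentPairs (y ∷ xs)

adjacentPairs-tabulate : ∀ {n} (g : Fin (suc n) → A) →
                         adjacentPairs (tabulate g) ≡ tabulate (λ i → g (inject₁ i) , g (suc i))
adjacentPairs-tabulate {n = ℕ.zero} g = refl
adjacentPairs-tabulate {n = suc n} g =
  cong ((g zero , g (suc zero)) ∷_) (adjacentPairs-tabulate (g ∘ suc))

consecutive-∈-adjacentPairs : ∀ {ℓ} {_≺_ : Rel A ℓ} → Asymmetric _≺_ →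
  ∀ {xs x y} → AllPairs _≺_ xs → x ∈ xs → y ∈ xs → x ≺ y → (∀ {z} → x ≺ z → ¬ z ≺ y) →
  (x , y) ∈ adjacentPairs xs
consecutive-∈-adjacentPairs asym _ (here refl) (here refl) x≺y _ = ⊥-elim (asym x≺y x≺y)
consecutive-∈-adjacentPairs asym _ (here refl) (there (here refl)) _ _ = here refl
consecutive-∈-adjacentPairs asym ((x≺z ∷ _) ∷ (z≺zs ∷ _)) (here refl) (there (there y∈zs)) _ nothing-between =
  contradiction (All.lookup z≺zs y∈zs) (nothing-between x≺z)
consecutive-∈-adjacentPairs asym (y≺xs ∷ _) (there x∈xs) (here refl) x≺y _ =
  ⊥-elim (asym x≺y (All.lookup y≺xs x∈xs))
consecutive-∈-adjacentPairs asym {xs = _ ∷ _ ∷ _} (_ ∷ sorted) (there x∈xs) (there y∈xs) x≺y nothing-between =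
  there (consecutive-∈-adjacentPairs asym sorted x∈xs y∈xs x≺y nothing-between)

module _ (_≟_ : DecidableEquality B) (f : A → B) where

  differ? : Decidable (λ (p : A × A) → f (proj₁ p) ≢ f (proj₂ p))
  differ? (x , y) = ¬? (f x ≟ f y)

  boundaries : List A → List (A × A)
  boundaries xs = filter differ? (adjacentPairs xs)

  length-boundaries : ∀ xs → length (boundaries xs) ≡ changes _≟_ (map f xs)
  length-boundaries []           = refl
  length-boundaries (x ∷ [])     = refl
  length-boundaries (x ∷ y ∷ xs) with f x ≟ f y | length-boundaries (y ∷ xs)
  ... | yes _ | ih = ih
  ... | no _  | ih = cong suc ih

runs≡suc-changes : (_≟_ : DecidableEquality A) → ∀ {x xs} → x ∈ xs → runs _≟_ xs ≡ suc (changes _≟_ xs)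
runs≡suc-changes _ {xs = _ ∷ _} _ = refl

unique-⊆⇒length≤ : ∀ {xs ys : List A} → Unique xs → xs ⊆ ys → length xs ≤ length ys
unique-⊆⇒length≤ {xs = []} _ _ = z≤n
unique-⊆⇒length≤ {xs = x ∷ xs} (x≢xs ∷ !xs) x∷xs⊆ys
  with ys₁ , ys₂ , refl ← ∈-∃++ (x∷xs⊆ys (here refl)) = begin
    suc (length xs)           ≤⟨ s≤s (unique-⊆⇒length≤ !xs xs⊆ys₁++ys₂) ⟩
    suc (length (ys₁ ++ ys₂)) ≡⟨ ↭-length (↭-sym (shift x ys₁ ys₂)) ⟩
    length (ys₁ ++ x ∷ ys₂)   ∎
  where
  open ℕ.≤-Reasoning
  xs⊆ys₁++ys₂ : xs ⊆ ys₁ ++ ys₂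
  xs⊆ys₁++ys₂ y∈xs with ∈-resp-↭ (shift x ys₁ ys₂) (x∷xs⊆ys (there y∈xs))
  ... | here refl = contradiction refl (All.lookup x≢xs y∈xs)
  ... | there y∈ys₁++ys₂ = y∈ys₁++ys₂

length-concatMap : (V : A → List B) → ∀ xs → length (concatMap V xs) ≡ sum (map (length ∘ V) xs)
length-concatMap V []       = refl
length-concatMap V (x ∷ xs) = trans (length-++ (V x)) (cong (length (V x) +_) (length-concatMap V xs))

sum-map-suc : (f : A → ℕ) → ∀ xs → sum (map (suc ∘ f) xs) ≡ length xs + sum (map f xs)
sum-map-suc f []       = refl
sum-map-suc f (x ∷ xs) =
  cong suc (trans (cong (f x +_) (sum-map-suc f xs)) (x∙yz≈y∙xz (f x) (length xs) _))

firstDifference : (_≟_ : DecidableEquality A) → ∀ {n} {u v : Vec A n} → u ≢ v →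
  ∃[ j ] take (toℕ j) (toList u) ≡ take (toℕ j) (toList v) × lookup u j ≢ lookup v j
firstDifference _≟_ {u = []} {[]} u≢v = contradiction refl u≢v
firstDifference _≟_ {u = x ∷ u} {y ∷ v} xu≢yv with x ≟ y
... | no x≢y = zero , refl , x≢y
... | yes refl with j , same-prefix , differ ← firstDifference _≟_ (xu≢yv ∘ cong (x ∷_)) =
  suc j , cong (x ∷_) same-prefix , differ

module _ (R : A → A → Bool) where

  insertBy-↭ : ∀ x ys → insertBy R x ys ↭ x ∷ ys
  insertBy-↭ x []       = ↭-refl
  insertBy-↭ x (y ∷ ys) with R x y
  ... | true  = ↭-refl
  ... | false = ↭-trans (↭-prep y (insertBy-↭ x ys)) (↭-swap y x ↭-refl)

  sortBy-↭ : ∀ xs → sortBy R xs ↭ xs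
  sortBy-↭ []       = ↭-refl
  sortBy-↭ (x ∷ xs) = ↭-trans (insertBy-↭ x (sortBy R xs)) (↭-prep x (sortBy-↭ xs))

  private
    _≺_ : Rel A 0ℓ
    x ≺ y = T (R x y)

  module _ (≺-trans : Transitive _≺_) (≺-connex : ∀ {x y} → x ≢ y → x ≺ y ⊎ y ≺ x) where

    insertBy-sorted : ∀ {x ys} → All (x ≢_) ys → AllPairs _≺_ ys → AllPairs _≺_ (insertBy R x ys)
    insertBy-sorted {x} {[]}     _            []            = [] ∷ []
    insertBy-sorted {x} {y ∷ ys} (x≢y ∷ x≢ys) (y≺ys ∷ ys↗) with R x y in R[x,y]
    ... | true  = (x≺y ∷ All.map (≺-trans x≺y) y≺ys) ∷ y≺ys ∷ ys↗
      where
      x≺y : x ≺ y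
      x≺y = Equivalence.from T-≡ R[x,y]
    ... | false = All-resp-↭ (↭-sym (insertBy-↭ x ys)) (y≺x ∷ y≺ys) ∷ insertBy-sorted x≢ys ys↗
      where
      y≺x : y ≺ x
      y≺x = Sum.[ (λ x≺y → ⊥-elim (subst T R[x,y] x≺y)) , id ] (≺-connex x≢y)

    sortBy-sorted : ∀ {xs} → Unique xs → AllPairs _≺_ (sortBy R xs)
    sortBy-sorted {[]}     []           = []
    sortBy-sorted {x ∷ xs} (x≢xs ∷ !xs) =
      insertBy-sorted (All-resp-↭ (↭-sym (sortBy-↭ xs)) x≢xs) (sortBy-sorted !xs)

T-lexLt⇒Lex-< : ∀ {as bs} → T (lexLt as bs) → Lex-< _≡_ _<_ as bs
T-lexLt⇒Lex-< {[]}     {_ ∷ _}  _ = halt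
T-lexLt⇒Lex-< {a ∷ as} {b ∷ bs} t with Equivalence.to T-∨ t
... | inj₁ a<b = this (ℕ.<ᵇ⇒< a b a<b)
... | inj₂ a≡b∧as<bs with a≡b , as<bs ← Equivalence.to T-∧ a≡b∧as<bs =
  next (ℕ.≡ᵇ⇒≡ a b a≡b) (T-lexLt⇒Lex-< as<bs)

Lex-<⇒T-lexLt : ∀ {as bs} → Lex-< _≡_ _<_ as bs → T (lexLt as bs)
Lex-<⇒T-lexLt (base ())
Lex-<⇒T-lexLt halt = _
Lex-<⇒T-lexLt (this {x = a} {y = b} a<b) = Equivalence.from (T-∨ {a <ᵇ b}) (inj₁ (ℕ.<⇒<ᵇ a<b))
Lex-<⇒T-lexLt (next {x = a} refl as<bs) =
  Equivalence.from (T-∨ {a <ᵇ a})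
    (inj₂ (Equivalence.from (T-∧ {a ≡ᵇ a}) (ℕ.≡⇒≡ᵇ a a refl , Lex-<⇒T-lexLt as<bs)))

T-listEq⇒Pointwise : ∀ {as bs} → T (listEq as bs) → Pointwise _≡_ as bs
T-listEq⇒Pointwise {[]}     {[]}     _ = []
T-listEq⇒Pointwise {a ∷ as} {b ∷ bs} t with a≡b , as≡bs ← Equivalence.to T-∧ t =
  ℕ.≡ᵇ⇒≡ a b a≡b ∷ T-listEq⇒Pointwise as≡bs

Pointwise⇒T-listEq : ∀ {as bs} → Pointwise _≡_ as bs → T (listEq as bs)
Pointwise⇒T-listEq []                     = _
Pointwise⇒T-listEq {a ∷ _} (refl ∷ as≡bs) =
  Equivalence.from (T-∧ {a ≡ᵇ a}) (ℕ.≡⇒≡ᵇ a a refl , Pointwise⇒T-listEq as≡bs)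

-- The co-lexicographic order of the paper, with ties broken by index, is this order on
-- the keys (reversed prefix, index).
_<ₗₑₓ_ : Rel (List ℕ × ℕ) 0ℓ
_<ₗₑₓ_ = ×-Lex (Pointwise _≡_) (Lex-< _≡_ _<_) _<_

<ₗₑₓ-isStrictTotalOrder : IsStrictTotalOrder (×-Pointwise (Pointwise _≡_) _≡_) _<ₗₑₓ_
<ₗₑₓ-isStrictTotalOrder =
  ×-isStrictTotalOrder (Lex.<-isStrictTotalOrder ℕ.<-isStrictTotalOrder) ℕ.<-isStrictTotalOrder

module <ₗₑₓ = IsStrictTotalOrder <ₗₑₓ-isStrictTotalOrder

T-colex⇒<ₗₑₓ : ∀ {as m bs n} → T (lexLt as bs ∨ (listEq as bs ∧ (m <ᵇ n))) → (as , m) <ₗₑₓ (bs , n)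
T-colex⇒<ₗₑₓ {m = m} {n = n} =
  Sum.map T-lexLt⇒Lex-< (Product.map T-listEq⇒Pointwise (ℕ.<ᵇ⇒< m n) ∘ Equivalence.to T-∧)
    ∘ Equivalence.to T-∨

<ₗₑₓ⇒T-colex : ∀ {as m bs n} → (as , m) <ₗₑₓ (bs , n) → T (lexLt as bs ∨ (listEq as bs ∧ (m <ᵇ n)))
<ₗₑₓ⇒T-colex =
  Equivalence.from T-∨
    ∘ Sum.map Lex-<⇒T-lexLt (Equivalence.from T-∧ ∘ Product.map Pointwise⇒T-listEq ℕ.<⇒<ᵇ)

module _ {ℓ₁ ℓ₂} {_≈_ : Rel A ℓ₁} {_≺_ : Rel A ℓ₂} (spo : IsStrictPartialOrder _≈_ _≺_) where

  open IsStrictPartialOrder spo using (irrefl; module Eq) renaming (trans to ≺-trans)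

  ×-Lex-nothing-between-suc : ∀ {a b m n} →
    ×-Lex _≈_ _≺_ _<_ (a , m) (b , n) → ¬ ×-Lex _≈_ _≺_ _<_ (b , n) (a , suc m)
  ×-Lex-nothing-between-suc (inj₁ a≺b)       (inj₁ b≺a)         = irrefl Eq.refl (≺-trans a≺b b≺a)
  ×-Lex-nothing-between-suc (inj₁ a≺b)       (inj₂ (b≈a , _))   = irrefl (Eq.sym b≈a) a≺b
  ×-Lex-nothing-between-suc (inj₂ (a≈b , _)) (inj₁ b≺a)         = irrefl (Eq.sym a≈b) b≺a
  ×-Lex-nothing-between-suc (inj₂ (_ , m<n)) (inj₂ (_ , n<1+m)) = ℕ.<⇒≱ m<n (ℕ.s≤s⁻¹ n<1+m)

module Column {h w σ} (S : Haplotypes h w σ) (j : Fin w) where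

  key : Fin h → List ℕ × ℕ
  key k = revPrefix S (toℕ j) k , toℕ k

  _≺_ : Rel (Fin h) 0ℓ
  k ≺ k′ = T (colexLt S (toℕ j) k k′)

  ≺⇒<ₗₑₓ : ∀ {k k′} → k ≺ k′ → key k <ₗₑₓ key k′
  ≺⇒<ₗₑₓ {k} {k′} = T-colex⇒<ₗₑₓ {revPrefix S (toℕ j) k} {toℕ k} {revPrefix S (toℕ j) k′} {toℕ k′}

  <ₗₑₓ⇒≺ : ∀ {k k′} → key k <ₗₑₓ key k′ → k ≺ k′
  <ₗₑₓ⇒≺ {k} {k′} = <ₗₑₓ⇒T-colex {revPrefix S (toℕ j) k} {toℕ k} {revPrefix S (toℕ j) k′} {toℕ k′}

  ≺-trans : Transitive _≺_
  ≺-trans k≺k′ k′≺k″ = <ₗₑₓ⇒≺ (<ₗₑₓ.trans (≺⇒<ₗₑₓ k≺k′) (≺⇒<ₗₑₓ k′≺k″))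

  ≺-asym : Asymmetric _≺_
  ≺-asym k≺k′ k′≺k = <ₗₑₓ.asym (≺⇒<ₗₑₓ k≺k′) (≺⇒<ₗₑₓ k′≺k)

  ≺-connex : ∀ {k k′} → k ≢ k′ → k ≺ k′ ⊎ k′ ≺ k
  ≺-connex {k} {k′} k≢k′ with <ₗₑₓ.compare (key k) (key k′)
  ... | tri< k<k′ _ _      = inj₁ (<ₗₑₓ⇒≺ k<k′)
  ... | tri≈ _ (_ , k≡k′) _ = contradiction (toℕ-injective k≡k′) k≢k′
  ... | tri> _ _ k′<k      = inj₂ (<ₗₑₓ⇒≺ k′<k)

  PAcol-sorted : AllPairs _≺_ (PAcol S j)
  PAcol-sorted = sortBy-sorted (colexLt S (toℕ j)) ≺-trans ≺-connex (Unique.allFin⁺ h)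

  ∈-PAcol : ∀ k → k ∈ PAcol S j
  ∈-PAcol k = ∈-resp-↭ (↭-sym (sortBy-↭ (colexLt S (toℕ j)) (allFin h))) (∈-allFin k)

  same-prefix⇒∈-adjacentPairs : ∀ {i i′} → revPrefix S (toℕ j) i ≡ revPrefix S (toℕ j) i′ →
    toℕ i′ ≡ suc (toℕ i) → (i , i′) ∈ adjacentPairs (PAcol S j)
  same-prefix⇒∈-adjacentPairs {i} {i′} same-prefix i′≡1+i =
    consecutive-∈-adjacentPairs ≺-asym PAcol-sorted (∈-PAcol i) (∈-PAcol i′) i≺i′ nothing-between
    where
    key[i′] : key i′ ≡ (revPrefix S (toℕ j) i , suc (toℕ i))
    key[i′] = cong₂ _,_ (sym same-prefix) i′≡1+i

    i≺i′ : i ≺ i′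
    i≺i′ = <ₗₑₓ⇒≺ (inj₂ (≡⇒Pointwise-≡ same-prefix , ℕ.≤-reflexive (sym i′≡1+i)))

    nothing-between : ∀ {k} → i ≺ k → ¬ k ≺ i′
    nothing-between i≺k k≺i′ =
      ×-Lex-nothing-between-suc (Lex.<-isStrictPartialOrder ℕ.<-isStrictPartialOrder)
        (≺⇒<ₗₑₓ i≺k) (subst (key _ <ₗₑₓ_) key[i′] (≺⇒<ₗₑₓ k≺i′))

adjacentPairs-allFin : ∀ n → adjacentPairs (allFin (suc n)) ≡ tabulate (λ i → inject₁ i , suc i)
adjacentPairs-allFin n = adjacentPairs-tabulate id

adjacentPairs-allFin-unique : ∀ n → Unique (adjacentPairs (allFin (suc n)))
adjacentPairs-allFin-unique n =
  subst Unique (sym (adjacentPairs-allFin n)) (Unique.tabulate⁺ (suc-injective ∘ cong proj₂))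

∈-adjacentPairs-allFin⁻ : ∀ {n} {i i′ : Fin (suc n)} → (i , i′) ∈ adjacentPairs (allFin (suc n)) →
  toℕ i′ ≡ suc (toℕ i)
∈-adjacentPairs-allFin⁻ {n} {i} {i′} adjacent
  with a , refl ← ∈-tabulate⁻ (subst ((i , i′) ∈_) (adjacentPairs-allFin n) adjacent) =
  cong suc (sym (toℕ-inject₁ a))

module _ {n w σ} (S : Haplotypes (suc n) w σ) where

  private
    _≟ᵥ_ : DecidableEquality (Vec (Fin σ) w)
    _≟ᵥ_ = Vec.≡-dec _≟_

  symbolAt : Fin w → Fin (suc n) → Fin σ
  symbolAt j k = lookup (S k) j

  PBWTchanges : Fin w → ℕ
  PBWTchanges j = changes _≟_ (PBWTcol S j)

  haplotypeBoundaries : List (Fin (suc n) × Fin (suc n))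
  haplotypeBoundaries = boundaries _≟ᵥ_ S (allFin (suc n))

  PBWTboundaries : Fin w → List (Fin (suc n) × Fin (suc n))
  PBWTboundaries j = boundaries _≟_ (symbolAt j) (PAcol S j)

  haplotypeBoundary⇒PBWTboundary : ∀ {p} → p ∈ haplotypeBoundaries → ∃[ j ] p ∈ PBWTboundaries j
  haplotypeBoundary⇒PBWTboundary {i , i′} p∈
    with adjacent , S[i]≢S[i′] ← ∈-filter⁻ (differ? _≟ᵥ_ S) p∈
    with j , same-prefix , differ ← firstDifference _≟_ S[i]≢S[i′] =
    j , ∈-filter⁺ (differ? _≟_ (symbolAt j))
          (Column.same-prefix⇒∈-adjacentPairs S j (cong (reverseL ∘ map toℕ) same-prefix)
            (∈-adjacentPairs-allFin⁻ adjacent))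
          differ

  h″≤ΣPBWTchanges : h″ S ≤ sum (map PBWTchanges (allFin w))
  h″≤ΣPBWTchanges = begin
    h″ S                                            ≡⟨ length-boundaries _≟ᵥ_ S (allFin (suc n)) ⟨
    length haplotypeBoundaries                      ≤⟨ unique-⊆⇒length≤ boundaries-unique boundaries-⊆ ⟩
    length (concatMap PBWTboundaries (allFin w))    ≡⟨ length-concatMap PBWTboundaries (allFin w) ⟩
    sum (map (length ∘ PBWTboundaries) (allFin w))  ≡⟨ cong sum (map-cong length-PBWTboundaries (allFin w)) ⟩
    sum (map PBWTchanges (allFin w))                ∎
    where
    open ℕ.≤-Reasoning
    boundaries-unique : Unique haplotypeBoundaries
    boundaries-unique = Unique.filter⁺ (differ? _≟ᵥ_ S) (adjacentPairs-allFin-unique n)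
    boundaries-⊆ : haplotypeBoundaries ⊆ concatMap PBWTboundaries (allFin w)
    boundaries-⊆ p∈ with j , p∈j ← haplotypeBoundary⇒PBWTboundary p∈ =
      ∈-concatMap⁺ PBWTboundaries (lose (∈-allFin j) p∈j)
    length-PBWTboundaries : ∀ j → length (PBWTboundaries j) ≡ PBWTchanges j
    length-PBWTboundaries j = length-boundaries _≟_ (symbolAt j) (PAcol S j)

  rTilde≡w+ΣPBWTchanges : rTilde S ≡ w + sum (map PBWTchanges (allFin w))
  rTilde≡w+ΣPBWTchanges = begin
    sum (map (runsCol S) (allFin w))          ≡⟨ cong sum (map-cong runs≡1+changes (allFin w)) ⟩
    sum (map (suc ∘ PBWTchanges) (allFin w))  ≡⟨ sum-map-suc PBWTchanges (allFin w) ⟩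
    length (allFin w) + Σchanges              ≡⟨ cong (_+ Σchanges) (length-tabulate id) ⟩
    w + Σchanges                              ∎
    where
    open ≡-Reasoning
    Σchanges : ℕ
    Σchanges = sum (map PBWTchanges (allFin w))
    runs≡1+changes : ∀ j → runsCol S j ≡ suc (PBWTchanges j)
    runs≡1+changes j = runs≡suc-changes _≟_ (∈-map⁺ (symbolAt j) (Column.∈-PAcol S j zero))

lemma3 : (h w σ : ℕ) → 1 ≤ h → 1 ≤ w → (S : Haplotypes h w σ) →
         suc (h″ S) ≤ rTilde S
lemma3 (suc n) (suc w) σ _ _ S = begin
  suc (h″ S)      ≤⟨ s≤s (h″≤ΣPBWTchanges S) ⟩
  suc Σchanges    ≤⟨ s≤s (ℕ.m≤n+m Σchanges w) ⟩
  suc w + Σchanges ≡⟨ rTilde≡w+ΣPBWTchanges S ⟨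
  rTilde S        ∎
  where
  open ℕ.≤-Reasoning
  Σchanges : ℕ
  Σchanges = sum (map (PBWTchanges S) (allFin (suc w)))
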